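{- Let $G$ be a finite simple graph in which every vertex is contained in a cycle, and let $g=\mathrm{girth}(G)$ (length of a shortest cycle). Then $ir_{cy}(G)=g-1$ if and only if $G$ contains a path on $g-1$ vertices such that every vertex not on the path is adjacent to both endpoints of the path and to no other vertex of the path.
   Context: For $S\subseteq V$, $\langle S\rangle$ is the induced subgraph. $S$ is cycle irredundant if for every $u\in S$, either $u$ is not contained in any cycle of $\langle S\rangle$, or there exists $v\in V\setminus S$ such that $v$ is contained in a cycle of $\langle S\cup\{v\}\rangle$ but not in any cycle of $\langle (S\setminus\{u\})\cup\{v\}\rangle$. $ir_{cy}(G)$ is the minimum size of a maximal cycle irredundant set (a cycle irredundant set with no cycle irredundant proper superset). -}

module Defs where

open import Data.Nat using (ℕ; zero; suc; _≤_; _∸_)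
open import Data.Bool using (Bool; true; false)
open import Data.Fin using (Fin; zero; suc; inject₁; fromℕ)
open import Data.Fin.Subset using (Subset; _∈_; _∉_; _∪_; _-_; ⁅_⁆; _⊂_; ∣_∣)
open import Data.Product using (Σ; ∃; _×_; _,_)
open import Data.Sum using (_⊎_)
open import Relation.Nullary using (¬_)
open import Relation.Binary.PropositionalEquality using (_≡_; _≢_)

record Graph (n : ℕ) : Set where
  field
    adj   : Fin n → Fin n → Bool
    sym   : ∀ u v → adj u v ≡ adj v u
    irrefl : ∀ v → adj v v ≡ false

module _ {n : ℕ} (G : Graph n) where
  open Graph G

  Adj : Fin n → Fin n → Set
  Adj u v = adj u v ≡ true

  -- A cycle of length (3 + m) in G: distinct vertices c₀ … c_{m+2}
  -- with c_i ~ c_{i+1} and c_{m+2} ~ c₀.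
  record Cycle (m : ℕ) : Set where
    field
      vs   : Fin (suc (suc (suc m))) → Fin n
      inj  : ∀ i j → vs i ≡ vs j → i ≡ j
      step : ∀ (i : Fin (suc (suc m))) → Adj (vs (inject₁ i)) (vs (suc i))
      close : Adj (vs (fromℕ (suc (suc m)))) (vs zero)

  HasCycleOfLength : ℕ → Set
  HasCycleOfLength k = Σ ℕ λ m → (k ≡ suc (suc (suc m))) × Cycle m

  IsGirth : ℕ → Set
  IsGirth g = HasCycleOfLength g × (∀ k → HasCycleOfLength k → g ≤ k)

  OnCycleIn : Subset n → Fin n → Set
  OnCycleIn S u = Σ ℕ λ m → Σ (Cycle m) λ C →
    (∀ i → Cycle.vs C i ∈ S) × ∃ λ i → Cycle.vs C i ≡ u

  EveryVertexOnCycle : Set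
  EveryVertexOnCycle = ∀ u → ∃ λ m → Σ (Cycle m) λ C → ∃ λ i → Cycle.vs C i ≡ u

  CycleIrredundant : Subset n → Set
  CycleIrredundant S = ∀ u → u ∈ S →
    ¬ OnCycleIn S u
    ⊎ (∃ λ v → v ∉ S × OnCycleIn (S ∪ ⁅ v ⁆) v × ¬ OnCycleIn ((S - u) ∪ ⁅ v ⁆) v)

  MaximalCycleIrredundant : Subset n → Set
  MaximalCycleIrredundant S =
    CycleIrredundant S × (∀ T → S ⊂ T → ¬ CycleIrredundant T)

  IsIrCy : ℕ → Set
  IsIrCy k = (∃ λ S → MaximalCycleIrredundant S × ∣ S ∣ ≡ k)
           × (∀ S → MaximalCycleIrredundant S → k ≤ ∣ S ∣)

  record SpecialPath (m : ℕ) : Set where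
    field
      vs   : Fin (suc m) → Fin n
      inj  : ∀ i j → vs i ≡ vs j → i ≡ j
      step : ∀ (i : Fin m) → Adj (vs (inject₁ i)) (vs (suc i))
      outside : ∀ w → (∀ i → vs i ≢ w) →
        Adj w (vs zero) × Adj w (vs (fromℕ m))
        × (∀ i → i ≢ zero → i ≢ fromℕ m → ¬ Adj w (vs i))

  HasSpecialPath : ℕ → Set
  HasSpecialPath k = Σ ℕ λ m → (k ≡ suc m) × SpecialPath m

-- A set with fewer than g vertices spans no cycle, so it is
-- cycle irredundant; hence a maximal cycle irredundant set S has at least g - 1 vertices,
-- since otherwise S plus any outside vertex would still be too small to span a cycle.
-- If |S| = g - 1, maximality forces for each x outside S a g-cycle in S ∪ {x} through x.
-- Removing x leaves a path through all of S, and an outside vertex adjacent to path vertices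
-- p_a and p_b (a < b) closes a cycle of length b - a + 2 ≥ g, so its path neighbours are
-- exactly the two endpoints. Conversely, the vertex set of such a path is cycle irredundant
-- (too small) and maximal: an added vertex x closes a g-cycle with the path, as does any
-- vertex v replacing it, so x violates cycle irredundance.
module Submission where

open import Defs
open import Data.Bool using (true)
open import Data.Bool.Properties using () renaming (_≟_ to _≟ᵇ_)
open import Data.Empty using (⊥-elim)
open import Data.Fin using (Fin; zero; suc; toℕ; fromℕ; inject₁)
  renaming (_<_ to _<ᶠ_)
open import Data.Fin.Properties
  using (_≟_; any?; all?; ¬∀⟶∃¬; <-cmp; 0≢1+n; suc-injective; inject₁-injective;
         toℕ-injective; toℕ-fromℕ; toℕ-inject₁; toℕ≤pred[n])
open import Data.Fin.Relation.Unary.Top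
  using (view; ‵fromℕ; ‵inj₁; view-fromℕ; view-inject₁)
open import Data.Fin.Subset
  using (Subset; _∈_; _∉_; _∪_; _-_; ⁅_⁆; _⊂_; ∣_∣; ⊥; inside; outside)
open import Data.Fin.Subset.Properties
  using (_∈?_; ∉⊥; x∈⁅x⁆; x∈⁅y⁆⇒x≡y; ∣⁅x⁆∣≡1; ∣⊥∣≡0; p⊆p∪q; x∈p∪q⁺; x∈p∪q⁻;
         x∈p∧x≢y⇒x∈p-y; x∈p⇒∣p-x∣<∣p∣)
open import Data.Nat using (ℕ; zero; suc; pred; _+_; _∸_; _≤_; _<_; _≤?_; z≤n; s≤s; s≤s⁻¹)
open import Data.Nat.Properties
  using (≤-reflexive; <⇒≤; ≤-trans; ≤-antisym; n≤1+n; 1+n≰n; <⇒≱; ≰⇒>; n≢0⇒n>0;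
         n≤0⇒n≡0; m∸n≤m; ∸-cancelʳ-≤; +-suc; +-comm; +-monoʳ-≤; +-cancelˡ-≡)
open import Data.Product using (Σ; ∃; _×_; _,_; proj₁; proj₂)
open import Data.Sum using (inj₁; inj₂)
open import Data.Vec using ([]; _∷_)
open import Data.Vec.Functional using (head; tail) renaming (_∷_ to _∷ᶠ_)
open import Function using (_∘_)
open import Relation.Binary.Definitions using (tri<; tri≈; tri>)
open import Relation.Binary.PropositionalEquality hiding (resp)
open import Relation.Nullary using (¬_; Dec; yes; no)
open import Relation.Nullary.Decidable using (map′; _×-dec_; _→-dec_)

∣p∪q∣≤∣p∣+∣q∣ : ∀ {n} (p q : Subset n) → ∣ p ∪ q ∣ ≤ ∣ p ∣ + ∣ q ∣
∣p∪q∣≤∣p∣+∣q∣ []            []            = z≤n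
∣p∪q∣≤∣p∣+∣q∣ (inside ∷ p)  (inside ∷ q)  =
  s≤s (≤-trans (∣p∪q∣≤∣p∣+∣q∣ p q) (+-monoʳ-≤ ∣ p ∣ (n≤1+n ∣ q ∣)))
∣p∪q∣≤∣p∣+∣q∣ (inside ∷ p)  (outside ∷ q) = s≤s (∣p∪q∣≤∣p∣+∣q∣ p q)
∣p∪q∣≤∣p∣+∣q∣ (outside ∷ p) (inside ∷ q)  =
  ≤-trans (s≤s (∣p∪q∣≤∣p∣+∣q∣ p q)) (≤-reflexive (sym (+-suc ∣ p ∣ ∣ q ∣)))
∣p∪q∣≤∣p∣+∣q∣ (outside ∷ p) (outside ∷ q) = ∣p∪q∣≤∣p∣+∣q∣ p q

∣p∪⁅x⁆∣≤1+∣p∣ : ∀ {n} (p : Subset n) x → ∣ p ∪ ⁅ x ⁆ ∣ ≤ suc ∣ p ∣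
∣p∪⁅x⁆∣≤1+∣p∣ p x = ≤-trans (∣p∪q∣≤∣p∣+∣q∣ p ⁅ x ⁆)
  (≤-reflexive (trans (cong (∣ p ∣ +_) (∣⁅x⁆∣≡1 x)) (+-comm ∣ p ∣ 1)))

x∉p⇒p⊂p∪⁅x⁆ : ∀ {n} {p : Subset n} {x} → x ∉ p → p ⊂ p ∪ ⁅ x ⁆
x∉p⇒p⊂p∪⁅x⁆ {x = x} x∉p = p⊆p∪q _ , x , x∈p∪q⁺ (inj₂ (x∈⁅x⁆ x)) , x∉p

x∈p∪⁅y⁆∧x≢y⇒x∈p : ∀ {n} {p : Subset n} {x y} → x ∈ p ∪ ⁅ y ⁆ → x ≢ y → x ∈ p
x∈p∪⁅y⁆∧x≢y⇒x∈p {p = p} {y = y} x∈p∪y x≢y with x∈p∪q⁻ p ⁅ y ⁆ x∈p∪y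
... | inj₁ x∈p = x∈p
... | inj₂ x∈y = ⊥-elim (x≢y (x∈⁅y⁆⇒x≡y y x∈y))

Injective : ∀ {k n} → (Fin k → Fin n) → Set
Injective f = ∀ i j → f i ≡ f j → i ≡ j

injective⇒≤∣p∣ : ∀ {k n} {p : Subset n} (f : Fin k → Fin n) →
  Injective f → (∀ i → f i ∈ p) → k ≤ ∣ p ∣
injective⇒≤∣p∣ {zero}  f _     _   = z≤n
injective⇒≤∣p∣ {suc k} f f-inj f∈p =
  ≤-trans (s≤s (injective⇒≤∣p∣ (f ∘ suc) (λ i j → suc-injective ∘ f-inj _ _) tail∈))
          (x∈p⇒∣p-x∣<∣p∣ (f∈p zero))
  where
  tail∈ : ∀ i → f (suc i) ∈ _ - f zero
  tail∈ i = x∈p∧x≢y⇒x∈p-y (f∈p (suc i)) (0≢1+n ∘ sym ∘ f-inj _ _)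

injective∧∣p∣≤k⇒onto : ∀ {k n} {p : Subset n} (f : Fin k → Fin n) →
  Injective f → (∀ i → f i ∈ p) → ∣ p ∣ ≤ k → ∀ {x} → x ∈ p → ∃ λ i → f i ≡ x
injective∧∣p∣≤k⇒onto f f-inj f∈p ∣p∣≤k {x} x∈p with any? (λ i → f i ≟ x)
... | yes hit  = hit
... | no  miss = ⊥-elim (1+n≰n (≤-trans (injective⇒≤∣p∣ (x ∷ᶠ f) x∷f-inj x∷f∈p) ∣p∣≤k))
  where
  x∷f-inj : Injective (x ∷ᶠ f)
  x∷f-inj zero    zero    _ = refl
  x∷f-inj zero    (suc j) e = ⊥-elim (miss (j , sym e))
  x∷f-inj (suc i) zero    e = ⊥-elim (miss (i , e))
  x∷f-inj (suc i) (suc j) e = cong suc (f-inj i j e)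
  x∷f∈p : ∀ i → (x ∷ᶠ f) i ∈ _
  x∷f∈p zero    = x∈p
  x∷f∈p (suc i) = f∈p i

image : ∀ {k n} → (Fin k → Fin n) → Subset n
image {zero}  f = ⊥
image {suc k} f = ⁅ head f ⁆ ∪ image (tail f)

∈-image : ∀ {k n} (f : Fin k → Fin n) i → f i ∈ image f
∈-image f zero    = x∈p∪q⁺ (inj₁ (x∈⁅x⁆ (head f)))
∈-image f (suc i) = x∈p∪q⁺ (inj₂ (∈-image (tail f) i))

image-∈ : ∀ {k n} (f : Fin k → Fin n) {x} → x ∈ image f → ∃ λ i → f i ≡ x
image-∈ {zero}  f x∈ = ⊥-elim (∉⊥ x∈)
image-∈ {suc k} f x∈ with x∈p∪q⁻ ⁅ head f ⁆ (image (tail f)) x∈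
... | inj₁ x∈head = zero , sym (x∈⁅y⁆⇒x≡y _ x∈head)
... | inj₂ x∈tail = let (i , e) = image-∈ (tail f) x∈tail in suc i , e

∉image⇒≢ : ∀ {k n} (f : Fin k → Fin n) {x} → x ∉ image f → ∀ i → f i ≢ x
∉image⇒≢ f x∉ i fi≡x = x∉ (subst (_∈ image f) fi≡x (∈-image f i))

∣image∣≤ : ∀ {k n} (f : Fin k → Fin n) → ∣ image f ∣ ≤ k
∣image∣≤ {zero} {n} f = ≤-reflexive (∣⊥∣≡0 n)
∣image∣≤ {suc k}    f = ≤-trans (∣p∪q∣≤∣p∣+∣q∣ ⁅ head f ⁆ (image (tail f)))
  (≤-trans (≤-reflexive (cong (_+ ∣ image (tail f) ∣) (∣⁅x⁆∣≡1 (head f))))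
           (s≤s (∣image∣≤ (tail f))))

any-function? : ∀ {k n} (P : (Fin k → Fin n) → Set) →
  (∀ {f g} → f ≗ g → P f → P g) → (∀ f → Dec (P f)) → Dec (∃ P)
any-function? {zero} P resp P? with P? (λ ())
... | yes Pf = yes (_ , Pf)
... | no ¬Pf = no λ (f , Pf) → ¬Pf (resp (λ ()) Pf)
any-function? {suc k} P resp P?
  with any? (λ x → any-function? (P ∘ (x ∷ᶠ_)) (resp ∘ ∷ᶠ-cong) (P? ∘ (x ∷ᶠ_)))
  where
  ∷ᶠ-cong : ∀ {x f g} → f ≗ g → (x ∷ᶠ f) ≗ (x ∷ᶠ g)
  ∷ᶠ-cong f≗g zero    = refl
  ∷ᶠ-cong f≗g (suc i) = f≗g i
... | yes (x , f , Pf) = yes (x ∷ᶠ f , Pf)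
... | no none = no λ (f , Pf) → none (head f , tail f , resp η Pf)
  where
  η : ∀ {f} → f ≗ head f ∷ᶠ tail f
  η zero    = refl
  η (suc i) = refl

cyclicSuc : ∀ {k} → Fin (suc k) → Fin (suc k)
cyclicSuc i with view i
... | ‵fromℕ          = zero
... | ‵inj₁ {i = j} _ = suc j

cyclicSuc-inject₁ : ∀ {k} (i : Fin k) → cyclicSuc (inject₁ i) ≡ suc i
cyclicSuc-inject₁ i rewrite view-inject₁ i = refl

cyclicSuc-fromℕ : ∀ k → cyclicSuc (fromℕ k) ≡ zero
cyclicSuc-fromℕ k rewrite view-fromℕ k = refl

cyclicSuc-injective : ∀ {k} → Injective (cyclicSuc {k})
cyclicSuc-injective i j e = trans (sym (prev-cyclicSuc i)) (trans (cong prev e) (prev-cyclicSuc j))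
  where
  prev : ∀ {k} → Fin (suc k) → Fin (suc k)
  prev zero    = fromℕ _
  prev (suc i) = inject₁ i
  prev-cyclicSuc : ∀ {k} (i : Fin (suc k)) → prev (cyclicSuc i) ≡ i
  prev-cyclicSuc i with view i
  ... | ‵fromℕ  = refl
  ... | ‵inj₁ _ = refl

module _ {n : ℕ} (G : Graph n) where

  Adj-sym : ∀ {u v} → Adj G u v → Adj G v u
  Adj-sym {u} {v} uv = trans (Graph.sym G v u) uv

  Adj? : ∀ u v → Dec (Adj G u v)
  Adj? u v = Graph.adj G u v ≟ᵇ true

  CycleIn : Subset n → ℕ → Set
  CycleIn T m = Σ (Cycle G m) λ C → ∀ i → Cycle.vs C i ∈ T

  CycleAt : Subset n → ℕ → Fin n → Set
  CycleAt T m x = Σ (CycleIn T m) λ (C , _) → Cycle.vs C zero ≡ x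

  cycleAt⇒onCycleIn : ∀ {T m x} → CycleAt T m x → OnCycleIn G T x
  cycleAt⇒onCycleIn ((C , C⊆T) , head≡x) = _ , C , C⊆T , zero , head≡x

  cycleIn⇒3+m≤∣T∣ : ∀ {T m} → CycleIn T m → 3 + m ≤ ∣ T ∣
  cycleIn⇒3+m≤∣T∣ (C , C⊆T) = injective⇒≤∣p∣ (Cycle.vs C) (Cycle.inj C) C⊆T

  girth≤ : ∀ {g m} → IsGirth G g → Cycle G m → g ≤ 3 + m
  girth≤ (_ , minimal) C = minimal _ (_ , refl , C)

  ∣T∣<girth⇒cycleIrredundant : ∀ {g T} → IsGirth G g → ∣ T ∣ < g → CycleIrredundant G T
  ∣T∣<girth⇒cycleIrredundant girth ∣T∣<g u _ =
    inj₁ λ (_ , C , C⊆T , _) → <⇒≱ ∣T∣<g (≤-trans (girth≤ girth C) (cycleIn⇒3+m≤∣T∣ (C , C⊆T)))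

  -- Opaque so that the type checker never runs this exhaustive search.
  opaque
    cycleIn? : ∀ T m → Dec (CycleIn T m)
    cycleIn? T m = map′ toCycle fromCycle (any-function? IsCycleIn resp isCycleIn?)
      where
      IsCycleIn : (Fin (3 + m) → Fin n) → Set
      IsCycleIn f = Injective f × (∀ i → Adj G (f (inject₁ i)) (f (suc i)))
                  × Adj G (f (fromℕ (2 + m))) (f zero) × (∀ i → f i ∈ T)
      resp : ∀ {f g} → f ≗ g → IsCycleIn f → IsCycleIn g
      resp f≗g (inj , step , close , f⊆T) =
          (λ i j e → inj i j (trans (f≗g i) (trans e (sym (f≗g j)))))
        , (λ i → subst₂ (Adj G) (f≗g _) (f≗g _) (step i))
        , subst₂ (Adj G) (f≗g _) (f≗g _) close
        , (λ i → subst (_∈ T) (f≗g i) (f⊆T i))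
      isCycleIn? : ∀ f → Dec (IsCycleIn f)
      isCycleIn? f = all? (λ i → all? λ j → (f i ≟ f j) →-dec (i ≟ j))
        ×-dec all? (λ i → Adj? _ _) ×-dec Adj? _ _ ×-dec all? (λ i → f i ∈? T)
      toCycle : ∃ IsCycleIn → CycleIn T m
      toCycle (f , inj , step , close , f⊆T) =
        record { vs = f ; inj = inj ; step = step ; close = close } , f⊆T
      fromCycle : CycleIn T m → ∃ IsCycleIn
      fromCycle (C , C⊆T) = Cycle.vs C , Cycle.inj C , Cycle.step C , Cycle.close C , C⊆T

  record IsPath {k} (p : Fin (suc k) → Fin n) : Set where
    field
      injective : Injective p
      adjacent  : ∀ i → Adj G (p (inject₁ i)) (p (suc i))

  dropFirst : ∀ {k} {p : Fin (2 + k) → Fin n} → IsPath p → IsPath (p ∘ suc)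
  dropFirst path = record
    { injective = λ i j → suc-injective ∘ IsPath.injective path _ _
    ; adjacent  = IsPath.adjacent path ∘ suc }

  dropLast : ∀ {k} {p : Fin (2 + k) → Fin n} → IsPath p → IsPath (p ∘ inject₁)
  dropLast path = record
    { injective = λ i j → inject₁-injective ∘ IsPath.injective path _ _
    ; adjacent  = IsPath.adjacent path ∘ inject₁ }

  module _ {m : ℕ} (C : Cycle G m) where
    open Cycle C

    adj-cyclicSuc : ∀ i → Adj G (vs i) (vs (cyclicSuc i))
    adj-cyclicSuc i with view i
    ... | ‵fromℕ          = close
    ... | ‵inj₁ {i = j} _ = step j

    tail-isPath : IsPath (vs ∘ suc)
    tail-isPath = record
      { injective = λ i j → suc-injective ∘ inj _ _
      ; adjacent  = step ∘ suc }

    tail≢head : ∀ i → vs (suc i) ≢ vs zero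
    tail≢head i = 0≢1+n ∘ sym ∘ inj _ _

    rotate₁ : Cycle G m
    rotate₁ = record
      { vs    = vs ∘ cyclicSuc
      ; inj   = λ i j → cyclicSuc-injective i j ∘ inj _ _
      ; step  = λ i → subst (λ v → Adj G (vs v) (vs (cyclicSuc (suc i))))
                            (sym (cyclicSuc-inject₁ i)) (adj-cyclicSuc (suc i))
      ; close = subst (λ v → Adj G (vs v) (vs (cyclicSuc zero)))
                      (sym (cyclicSuc-fromℕ (2 + m))) (adj-cyclicSuc zero)
      }

  cycleIn⇒cycleAt : ∀ {T m} ((C , _) : CycleIn T m) i → CycleAt T m (Cycle.vs C i)
  cycleIn⇒cycleAt C i = rotate (toℕ i) C i refl
    where
    rotate : ∀ {T m} t ((C , _) : CycleIn T m) i → toℕ i ≡ t → CycleAt T m (Cycle.vs C i)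
    rotate zero    C         zero    _  = C , refl
    rotate (suc t) (C , C⊆T) (suc i) eq
      with rotate t (rotate₁ C , C⊆T ∘ cyclicSuc) (inject₁ i) (trans (toℕ-inject₁ i) (cong pred eq))
    ... | C′ , head≡ = C′ , trans head≡ (cong (Cycle.vs C) (cyclicSuc-inject₁ i))

  closePath : ∀ {k y} {p : Fin (2 + k) → Fin n} → IsPath p → (∀ i → p i ≢ y) →
    Adj G y (p zero) → Adj G y (p (fromℕ (suc k))) → Cycle G k
  closePath {k} {y} {p} path avoid y~first y~last = record
    { vs = y ∷ᶠ p ; inj = inj ; step = step ; close = Adj-sym y~last }
    where
    inj : Injective (y ∷ᶠ p)
    inj zero    zero    _ = refl
    inj zero    (suc j) e = ⊥-elim (avoid j (sym e))
    inj (suc i) zero    e = ⊥-elim (avoid i e)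
    inj (suc i) (suc j) e = cong suc (IsPath.injective path i j e)
    step : ∀ i → Adj G ((y ∷ᶠ p) (inject₁ i)) ((y ∷ᶠ p) (suc i))
    step zero    = y~first
    step (suc i) = IsPath.adjacent path i

  chordCycle : ∀ {k y} {p : Fin (suc k) → Fin n} → IsPath p → (∀ i → p i ≢ y) →
    ∀ {a b} → a <ᶠ b → Adj G y (p a) → Adj G y (p b) →
    HasCycleOfLength G (2 + (toℕ b ∸ toℕ a))
  chordCycle {zero} _ _ {zero} {zero} ()
  chordCycle {suc k} path avoid {suc a} {suc b} a<b y~a y~b =
    chordCycle (dropFirst path) (avoid ∘ suc) (s≤s⁻¹ a<b) y~a y~b
  chordCycle {suc k} path avoid {zero} {b} 0<b y~a y~b with view b
  ... | ‵fromℕ = k , cong (3 +_) (toℕ-fromℕ k) , closePath path avoid y~a y~b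
  ... | ‵inj₁ {i = b′} _ =
    subst (λ t → HasCycleOfLength G (2 + t)) (sym (toℕ-inject₁ b′))
      (chordCycle (dropLast path) (avoid ∘ inject₁) {zero} {b′}
        (subst (0 <_) (toℕ-inject₁ b′) 0<b) y~a y~b)

  chord⇒endpoints : ∀ {k y} {p : Fin (suc k) → Fin n} → IsGirth G (2 + k) → IsPath p →
    (∀ i → p i ≢ y) → ∀ {a b} → a <ᶠ b → Adj G y (p a) → Adj G y (p b) →
    a ≡ zero × b ≡ fromℕ k
  chord⇒endpoints {k} (_ , minimal) path avoid {a} {b} a<b y~a y~b =
    toℕ-injective (n≤0⇒n≡0 a≤0) , toℕ-injective (trans b≡k (sym (toℕ-fromℕ k)))
    where
    k≤b∸a : k ≤ toℕ b ∸ toℕ a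
    k≤b∸a = s≤s⁻¹ (s≤s⁻¹ (minimal _ (chordCycle path avoid a<b y~a y~b)))
    b≤k : toℕ b ≤ k
    b≤k = toℕ≤pred[n] b
    a≤0 : toℕ a ≤ 0
    a≤0 = ∸-cancelʳ-≤ (<⇒≤ a<b) (≤-trans b≤k k≤b∸a)
    b≡k : toℕ b ≡ k
    b≡k = ≤-antisym b≤k (≤-trans k≤b∸a (m∸n≤m (toℕ b) (toℕ a)))

  twoNeighbours⇒endpointsOnly : ∀ {k y} {p : Fin (suc k) → Fin n} → IsGirth G (2 + k) →
    IsPath p → (∀ i → p i ≢ y) → ∀ {a b} → a ≢ b → Adj G y (p a) → Adj G y (p b) →
    Adj G y (p zero) × Adj G y (p (fromℕ k)) × (∀ i → i ≢ zero → i ≢ fromℕ k → ¬ Adj G y (p i))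
  twoNeighbours⇒endpointsOnly {k} {y} {p} girth path avoid {a} {b} a≢b y~a y~b =
    proj₁ ends , proj₂ ends , inner
    where
    spanning : ∀ {c d} → c <ᶠ d → Adj G y (p c) → Adj G y (p d) →
      Adj G y (p zero) × Adj G y (p (fromℕ k))
    spanning c<d y~c y~d =
      let (c≡0 , d≡k) = chord⇒endpoints girth path avoid c<d y~c y~d
      in subst (Adj G y ∘ p) c≡0 y~c , subst (Adj G y ∘ p) d≡k y~d
    ends : Adj G y (p zero) × Adj G y (p (fromℕ k))
    ends with <-cmp a b
    ... | tri< a<b _ _ = spanning a<b y~a y~b
    ... | tri≈ _ a≡b _ = ⊥-elim (a≢b a≡b)
    ... | tri> _ _ b<a = spanning b<a y~b y~a
    inner : ∀ i → i ≢ zero → i ≢ fromℕ k → ¬ Adj G y (p i)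
    inner i i≢0 i≢k y~i =
      i≢k (proj₂ (chord⇒endpoints girth path avoid {zero} (n≢0⇒n>0 (i≢0 ∘ toℕ-injective))
                    (proj₁ ends) y~i))

  ∣S∣<girth⇒∃∉ : ∀ {g} {S : Subset n} → IsGirth G g → ∣ S ∣ < g → ∃ λ x → x ∉ S
  ∣S∣<girth⇒∃∉ {S = S} girth@((_ , refl , C) , _) ∣S∣<g with all? (_∈? S)
  ... | yes everything = ⊥-elim (<⇒≱ ∣S∣<g (cycleIn⇒3+m≤∣T∣ (C , λ _ → everything _)))
  ... | no ¬everything = ¬∀⟶∃¬ n _ (_∈? S) ¬everything

  maximal⇒2+m≤∣S∣ : ∀ {m} {S : Subset n} → IsGirth G (3 + m) → MaximalCycleIrredundant G S → 2 + m ≤ ∣ S ∣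
  maximal⇒2+m≤∣S∣ {m} {S} girth (_ , S-max) with 2 + m ≤? ∣ S ∣
  ... | yes large = large
  ... | no ¬large =
    let ∣S∣<2+m  = ≰⇒> ¬large
        x , x∉S = ∣S∣<girth⇒∃∉ girth (≤-trans ∣S∣<2+m (n≤1+n _))
    in ⊥-elim (S-max _ (x∉p⇒p⊂p∪⁅x⁆ x∉S) (∣T∣<girth⇒cycleIrredundant girth
                 (s≤s (≤-trans (∣p∪⁅x⁆∣≤1+∣p∣ S x) ∣S∣<2+m))))

  module _ {m : ℕ} {S : Subset n} (girth : IsGirth G (3 + m))
           (S-max : MaximalCycleIrredundant G S) (∣S∣≡2+m : ∣ S ∣ ≡ 2 + m) where

    -- By maximality S ∪ ⁅ x ⁆ has a cycle, and it is too small for one longer than the girth.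
    cycleIn-S∪ : ∀ {x} → x ∉ S → CycleIn (S ∪ ⁅ x ⁆) m
    cycleIn-S∪ {x} x∉S with cycleIn? (S ∪ ⁅ x ⁆) m
    ... | yes C = C
    ... | no ¬C = ⊥-elim (proj₂ S-max _ (x∉p⇒p⊂p∪⁅x⁆ x∉S) λ _ _ →
          inj₁ λ (_ , C , C⊆T , _) → ¬C (subst (CycleIn _) (length≡girth C C⊆T) (C , C⊆T)))
      where
      length≡girth : ∀ {m′} (C : Cycle G m′) → (∀ i → Cycle.vs C i ∈ S ∪ ⁅ x ⁆) → m′ ≡ m
      length≡girth C C⊆T = +-cancelˡ-≡ 3 _ _ (≤-antisym
        (≤-trans (cycleIn⇒3+m≤∣T∣ (C , C⊆T))
                 (≤-trans (∣p∪⁅x⁆∣≤1+∣p∣ S x) (≤-reflexive (cong suc ∣S∣≡2+m))))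
        (girth≤ girth C))

    cycleAt-S∪ : ∀ {x} → x ∉ S → CycleAt (S ∪ ⁅ x ⁆) m x
    cycleAt-S∪ {x} x∉S with cycleIn-S∪ x∉S
    ... | C , C⊆T with any? (λ i → Cycle.vs C i ≟ x)
    ...   | yes (i , vs≡x) = subst (CycleAt _ m) vs≡x (cycleIn⇒cycleAt (C , C⊆T) i)
    ...   | no ¬hit = ⊥-elim (1+n≰n (≤-trans
            (cycleIn⇒3+m≤∣T∣ (C , λ i → x∈p∪⁅y⁆∧x≢y⇒x∈p (C⊆T i) (¬hit ∘ (i ,_))))
            (≤-reflexive ∣S∣≡2+m)))

    tail∈S : ∀ {x} (((C , _) , _) : CycleAt (S ∪ ⁅ x ⁆) m x) i → Cycle.vs C (suc i) ∈ S
    tail∈S ((C , C⊆T) , refl) i = x∈p∪⁅y⁆∧x≢y⇒x∈p (C⊆T (suc i)) (tail≢head C i)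

    maximal⇒specialPath : SpecialPath G (suc m)
    maximal⇒specialPath = record
      { vs = p ; inj = IsPath.injective path ; step = IsPath.adjacent path ; outside = off-path }
      where
      Cw : CycleAt (S ∪ ⁅ _ ⁆) m _
      Cw = cycleAt-S∪ (proj₂ (∣S∣<girth⇒∃∉ girth (≤-reflexive (cong suc ∣S∣≡2+m))))
      C = proj₁ (proj₁ Cw)
      p : Fin (2 + m) → Fin n
      p = Cycle.vs C ∘ suc
      path : IsPath p
      path = tail-isPath C
      onto : ∀ {x} → x ∈ S → ∃ λ i → p i ≡ x
      onto = injective∧∣p∣≤k⇒onto p (IsPath.injective path) (tail∈S Cw) (≤-reflexive ∣S∣≡2+m)
      neighbours : ∀ {y} → CycleAt (S ∪ ⁅ y ⁆) m y →
        ∃ λ a → ∃ λ b → a ≢ b × Adj G y (p a) × Adj G y (p b)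
      neighbours Cy@((D , _) , refl)
        with onto (tail∈S Cy zero) | onto (tail∈S Cy (fromℕ (suc m)))
      ... | a , pa≡ | b , pb≡ = a , b , a≢b
          , subst (Adj G _) (sym pa≡) (Cycle.step D zero)
          , subst (Adj G _) (sym pb≡) (Adj-sym (Cycle.close D))
        where
        a≢b : a ≢ b
        a≢b refl = 0≢1+n (suc-injective (Cycle.inj D _ _ (trans (sym pa≡) pb≡)))
      off-path : ∀ y → (∀ i → p i ≢ y) → Adj G y (p zero) × Adj G y (p (fromℕ (suc m)))
        × (∀ i → i ≢ zero → i ≢ fromℕ (suc m) → ¬ Adj G y (p i))
      off-path y avoid =
        let a , b , a≢b , y~a , y~b = neighbours (cycleAt-S∪ y∉S)
        in twoNeighbours⇒endpointsOnly girth path avoid a≢b y~a y~b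
        where
        y∉S : y ∉ S
        y∉S y∈S = let i , pi≡y = onto y∈S in avoid i pi≡y

  module _ {m : ℕ} (girth : IsGirth G (3 + m)) (sp : SpecialPath G (suc m)) where
    open SpecialPath sp renaming (vs to p; outside to off-path)

    offPath⇒onCycleIn : ∀ {y U} → y ∉ image p → y ∈ U → (∀ i → p i ∈ U) → OnCycleIn G U y
    offPath⇒onCycleIn {y} y∉p y∈U p⊆U =
      cycleAt⇒onCycleIn ((closePath path avoid y~first y~last , C⊆U) , refl)
      where
      path : IsPath p
      path = record { injective = inj ; adjacent = step }
      avoid : ∀ i → p i ≢ y
      avoid = ∉image⇒≢ p y∉p
      y~first = proj₁ (off-path y avoid)
      y~last  = proj₁ (proj₂ (off-path y avoid))
      C⊆U : ∀ i → (y ∷ᶠ p) i ∈ _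
      C⊆U zero    = y∈U
      C⊆U (suc i) = p⊆U i

    specialPath⇒maximal : MaximalCycleIrredundant G (image p)
    specialPath⇒maximal =
      ∣T∣<girth⇒cycleIrredundant girth (s≤s (∣image∣≤ p)) , notIrredundant
      where
      notIrredundant : ∀ T → image p ⊂ T → ¬ CycleIrredundant G T
      notIrredundant T (S⊆T , x , x∈T , x∉S) T-irr with T-irr x x∈T
      ... | inj₁ ¬onCycle = ¬onCycle (offPath⇒onCycleIn x∉S x∈T (S⊆T ∘ ∈-image p))
      ... | inj₂ (v , v∉T , _ , ¬onCycle) = ¬onCycle (offPath⇒onCycleIn (v∉T ∘ S⊆T)
            (x∈p∪q⁺ (inj₂ (x∈⁅x⁆ v)))
            (λ i → x∈p∪q⁺ (inj₁ (x∈p∧x≢y⇒x∈p-y (S⊆T (∈-image p i)) (∉image⇒≢ p x∉S i)))))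

mainTheorem13 : ∀ {n : ℕ} (G : Graph n) → EveryVertexOnCycle G →
    ∀ (g k : ℕ) → IsGirth G g → IsIrCy G k →
    (k ≡ g ∸ 1 → HasSpecialPath G (g ∸ 1)) × (HasSpecialPath G (g ∸ 1) → k ≡ g ∸ 1)
mainTheorem13 G _ g k girth@((m , refl , _) , _) ((S , S-max , ∣S∣≡k) , k-minimal) =
  forward , backward
  where
  forward : k ≡ 2 + m → HasSpecialPath G (2 + m)
  forward refl = suc m , refl , maximal⇒specialPath G girth S-max ∣S∣≡k
  backward : HasSpecialPath G (2 + m) → k ≡ 2 + m
  backward (_ , refl , sp) = ≤-antisym
    (≤-trans (k-minimal _ (specialPath⇒maximal G girth sp)) (∣image∣≤ (SpecialPath.vs sp)))
    (subst (2 + m ≤_) ∣S∣≡k (maximal⇒2+m≤∣S∣ G girth S-max))
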